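{- For any FH model $\mathsf{K}_{\mathsf{At}}$ (the top model of a category of FH models $\mathcal{C}(\mathsf{K}_{\mathsf{At}})$), its HMS-transform $HMS(\mathsf{K}_{\mathsf{At}})$ is a complemented HMS model.
   Context: Fix non-empty sets $\mathsf{At}$, $I$. Language $\mathcal{L}_{\mathsf{At}}$: $\varphi::=\top\mid p\mid\neg\varphi\mid\varphi\wedge\psi\mid\ell_i\varphi\mid a_i\varphi\mid k_i\varphi$; $\mathsf{At}(\varphi)$ = atoms in $\varphi$, $\mathsf{At}(A)=\bigcup_{\varphi\in A}\mathsf{At}(\varphi)$; $\mathcal{L}_\Phi=\{\varphi:\mathsf{At}(\varphi)\subseteq\Phi\}$. FH model for $\Phi$: $\mathsf{K}_\Phi=\langle I,W_\Phi,(R_{\Phi,i}),(\mathcal{A}_{\Phi,i}),V_\Phi\rangle$, $W_\Phi\ne\emptyset$, $R_{\Phi,i}$ equivalence relations, $\mathcal{A}_{\Phi,i}:W_\Phi\to2^{\mathcal{L}_\Phi}$ with $\varphi\in\mathcal{A}_{\Phi,i}(w)$ iff all $p\in\mathsf{At}(\varphi)$ are in it, and $(w,t)\in R_{\Phi,i}\Rightarrow\mathcal{A}_{\Phi,i}(w)=\mathcal{A}_{\Phi,i}(t)$; $V_\Phi:\Phi\to2^{W_\Phi}$. Surjective bounded morphism $f^\Phi_\Psi$ ($\Psi\subseteq\Phi$): surjection $W_\Phi\to W_\Psi$ with $w\in V_\Phi(p)\iff f^\Phi_\Psi(w)\in V_\Psi(p)$ ($p\in\Psi$); $\mathcal{A}_{\Phi,i}(w)\cap\mathcal{L}_\Psi=\mathcal{A}_{\Psi,i}(f^\Phi_\Psi(w))$;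 homomorphism for $R$; Back: if $(f^\Phi_\Psi(w),t')\in R_{\Psi,i}$ then some $t$ has $f^\Phi_\Psi(t)=t'$, $(w,t)\in R_{\Phi,i}$. A category of FH models $\mathcal{C}(\mathsf{K}_{\mathsf{At}})$: one $\mathsf{K}_\Phi$ per $\Phi\subseteq\mathsf{At}$ and one $f^\Phi_\Psi$ per $\Psi\subseteq\Phi$, $f^\Phi_\Phi=\mathrm{id}$, $f^\Phi_\Upsilon=f^\Psi_\Upsilon\circ f^\Phi_\Psi$. HMS-transform: $S_\Phi:=W_\Phi$, $\Omega=\bigcup_\Phi S_\Phi$, $r^\Phi_\Psi:=f^\Phi_\Psi$, $\omega_\Psi:=r^\Phi_\Psi(\omega)$, $D_\Psi=D_{S_\Psi}:=r^\Phi_\Psi(D)$; for $w\in S_\Phi$, $\Lambda_i(w)=\{w':(w,w')\in R_{\Phi,i}\}$; for $w\in S_\Psi$, $\alpha_i(w)=S_{\mathsf{At}(\mathcal{A}_{\Psi,i}(w))}$; $v(p)=\bigcup_{\Phi\ni p}V_\Phi(p)$; $\Pi_i(\omega_\Phi):=\Lambda_i(\omega)_{\alpha_i(\omega_\Phi)}$ for all $\omega$, $\Phi$ (with $\omega_\Phi$ defined); $HMS(\mathsf{K}_{\mathsf{At}}):=\langle I,\{S_\Phi\},(r^\Phi_\Psi),(\Lambda_i),(\Pi_i),v\rangle$. Complemented HMS model: non-empty pairwise disjoint $S_\Phi$ ordered $S_{\Phi'}\succeq S_\Phi$ iff $\Phi\subseteq\Phi'$; surjections $r^\Phi_\Psi$,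 $r^\Phi_\Phi=\mathrm{id}$, $r^\Phi_\Upsilon=r^\Psi_\Upsilon\circ r^\Phi_\Psi$; $D^\uparrow=\bigcup_{\Phi\subseteq\Psi}(r^\Psi_\Phi)^{ -1}(D)$ for $D\subseteq S_\Phi$; events are sets $D^\uparrow$; $v$ maps atoms to events; $\Pi_i:\Omega\to2^\Omega\setminus\{\emptyset\}$ with Confinement ($\omega\in S_\Phi\Rightarrow\Pi_i(\omega)\subseteq S_\Psi$ for some $\Psi\subseteq\Phi$, denoted $S_{\Pi_i(\omega)}$), Generalized Reflexivity ($\omega\in\Pi_i(\omega)^\uparrow$), Stationarity, Projections Preserve Ignorance ($\omega\in S_\Phi,\Psi\subseteq\Phi\Rightarrow\Pi_i(\omega)^\uparrow\subseteq\Pi_i(\omega_\Psi)^\uparrow$), Projections Preserve Knowledge ($\Upsilon\subseteq\Psi\subseteq\Phi$, $\omega\in S_\Phi$, $\Pi_i(\omega)\subseteq S_\Psi\Rightarrow\Pi_i(\omega)_\Upsilon=\Pi_i(\omega_\Upsilon)$); $\Lambda_i:\Omega\to2^\Omega$ with Reflexivity, Stationarity, Projections Preserve Implicit Knowledge ($\Lambda_i(\omega)_\Psi=\Lambda_i(\omega_\Psi)$ for $\omega\in S_\Phi$, $\Psi\subseteq\Phi$), Explicit Measurability ($\omega'\in\Lambda_i(\omega)\Rightarrow\Pi_i(\omega')=\Pi_i(\omega)$), Implicit Measurability ($\omega'\in\Pi_i(\omega)\Rightarrow\Lambda_i(\omega')=\Lambda_i(\omega)_{S_{\Pi_i(\omega)}}$).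 -}

module Defs where

open import Data.Product using (Σ; ∃; _×_; _,_; proj₁; proj₂)
open import Data.Sum using (_⊎_)
open import Data.Empty using (⊥)
open import Level using (Lift; 0ℓ) renaming (suc to lsuc)
open import Function.Bundles using (_⇔_)
open import Relation.Binary.Structures using (IsEquivalence)
open import Relation.Binary.PropositionalEquality using (_≡_)

module _ (At I : Set) where

  data Form : Set where
    ⊤ᶠ    : Form
    atom  : At → Form
    ¬ᶠ_   : Form → Form
    _∧ᶠ_  : Form → Form → Form
    ℓᶠ    : I → Form → Form
    aᶠ    : I → Form → Form
    kᶠ    : I → Form → Form

  atoms : Form → At → Set
  atoms ⊤ᶠ        p = ⊥
  atoms (atom q)  p = p ≡ q
  atoms (¬ᶠ φ)    p = atoms φ p
  atoms (φ ∧ᶠ ψ)  p = atoms φ p ⊎ atoms ψ p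
  atoms (ℓᶠ i φ)  p = atoms φ p
  atoms (aᶠ i φ)  p = atoms φ p
  atoms (kᶠ i φ)  p = atoms φ p

  Sub : Set₁
  Sub = At → Set

  _⊆ₛ_ : Sub → Sub → Set
  Ψ ⊆ₛ Φ = ∀ p → Ψ p → Φ p

  _≐ₛ_ : Sub → Sub → Set
  Ψ ≐ₛ Φ = (Ψ ⊆ₛ Φ) × (Φ ⊆ₛ Ψ)

  ⊆ₛ-trans : {Υ Ψ Φ : Sub} → Υ ⊆ₛ Ψ → Ψ ⊆ₛ Φ → Υ ⊆ₛ Φ
  ⊆ₛ-trans h₁ h₂ p x = h₂ p (h₁ p x)

  L : Sub → Form → Set
  L Φ φ = atoms φ ⊆ₛ Φ

  AtOf : (Form → Set) → Sub
  AtOf A p = Σ Form (λ φ → A φ × atoms φ p)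

  record FHModel (Φ : Sub) : Set₁ where
    field
      W      : Set
      w₀     : W
      R      : I → W → W → Set
      R-eq   : ∀ i → IsEquivalence (R i)
      Aw     : I → W → Form → Set
      Aw-L   : ∀ i w φ → Aw i w φ → L Φ φ
      Aw-gen : ∀ i w φ → Aw i w φ ⇔ (∀ p → atoms φ p → Aw i w (atom p))
      Aw-R   : ∀ i w t → R i w t → ∀ φ → Aw i w φ ⇔ Aw i t φ
      V      : (p : At) → Φ p → W → Set

  record FHCategory : Set₁ where
    field
      K : (Φ : Sub) → FHModel Φ
    open module KΦ (Φ : Sub) = FHModel (K Φ)
    field
      f      : ∀ {Φ Ψ} → Ψ ⊆ₛ Φ → W Φ → W Ψ
      f-surj : ∀ {Φ Ψ} (h : Ψ ⊆ₛ Φ) (t : W Ψ) → ∃ λ w → f h w ≡ t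
      f-V    : ∀ {Φ Ψ} (h : Ψ ⊆ₛ Φ) p (hΨ : Ψ p) (hΦ : Φ p) (w : W Φ) →
               V Φ p hΦ w ⇔ V Ψ p hΨ (f h w)
      f-Aw   : ∀ {Φ Ψ} (h : Ψ ⊆ₛ Φ) i (w : W Φ) φ →
               (Aw Φ i w φ × L Ψ φ) ⇔ Aw Ψ i (f h w) φ
      f-hom  : ∀ {Φ Ψ} (h : Ψ ⊆ₛ Φ) i (w t : W Φ) →
               R Φ i w t → R Ψ i (f h w) (f h t)
      f-back : ∀ {Φ Ψ} (h : Ψ ⊆ₛ Φ) i (w : W Φ) (t′ : W Ψ) →
               R Ψ i (f h w) t′ → ∃ λ t → f h t ≡ t′ × R Φ i w t
      f-id   : ∀ {Φ} (h : Φ ⊆ₛ Φ) (w : W Φ) → f h w ≡ w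
      f-comp : ∀ {Φ Ψ Υ} (h₁ : Υ ⊆ₛ Φ) (h₂ : Υ ⊆ₛ Ψ) (h₃ : Ψ ⊆ₛ Φ) (w : W Φ) →
               f h₁ w ≡ f h₂ (f h₃ w)

  record HMSData : Set₂ where
    field
      S : Sub → Set
      r : ∀ {Φ Ψ} → Ψ ⊆ₛ Φ → S Φ → S Ψ
    Ω : Set₁
    Ω = Σ Sub S
    field
      Λ : I → Ω → Ω → Set₁
      Π : I → Ω → Ω → Set₁
      v : At → Ω → Set₁

  module HMSNotions (M : HMSData) where
    open HMSData M

    -- identification of points of Ω (S_Φ = S_Φ' when Φ ≐ Φ')
    _≈_ : Ω → Ω → Set
    (Φ , s) ≈ (Φ′ , s′) = Σ (Φ′ ⊆ₛ Φ) (λ h → (Φ ⊆ₛ Φ′) × (r h s ≡ s′))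

    _⊑_ : (Ω → Set₁) → (Ω → Set₁) → Set₁
    X ⊑ Y = ∀ ω → X ω → ∃ λ ω′ → Y ω′ × (ω ≈ ω′)

    _≋_ : (Ω → Set₁) → (Ω → Set₁) → Set₁
    X ≋ Y = (X ⊑ Y) × (Y ⊑ X)

    _⊆S_ : (Ω → Set₁) → Sub → Set₁
    X ⊆S Ψ = ∀ ω → X ω → proj₁ ω ≐ₛ Ψ

    _∣_ : (Ω → Set₁) → (Ψ : Sub) → S Ψ → Set₁
    (X ∣ Ψ) s = Σ Ω (λ ω → X ω × (ω ≈ (Ψ , s)))

    up : (Φ : Sub) → (S Φ → Set₁) → Ω → Set₁
    up Φ D (Ψ , s) = Σ (Φ ⊆ₛ Ψ) (λ h → D (r h s))

    upSet : Sub → (Ω → Set₁) → Ω → Set₁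
    upSet Ψ X = up Ψ (X ∣ Ψ)

    proj : (Φ Ψ : Sub) → Ψ ⊆ₛ Φ → (Ω → Set₁) → Ω → Set₁
    proj Φ Ψ h X ω = Σ (S Φ) (λ s → (X ∣ Φ) s × (ω ≡ (Ψ , r h s)))

    IsEvent : (Ω → Set₁) → Set₂
    IsEvent E = Σ Sub (λ Φ → Σ (S Φ → Set₁) (λ D →
                  ((∀ ω → E ω → up Φ D ω) × (∀ ω → up Φ D ω → E ω))))

  record IsComplementedHMS (M : HMSData) : Set₂ where
    open HMSData M
    open HMSNotions M
    field
      S-nonempty : (Φ : Sub) → S Φ
      r-surj     : ∀ {Φ Ψ} (h : Ψ ⊆ₛ Φ) (t : S Ψ) → ∃ λ s → r h s ≡ t
      r-id       : ∀ {Φ} (h : Φ ⊆ₛ Φ) (s : S Φ) → r h s ≡ s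
      r-comp     : ∀ {Φ Ψ Υ} (h₁ : Υ ⊆ₛ Φ) (h₂ : Υ ⊆ₛ Ψ) (h₃ : Ψ ⊆ₛ Φ) (s : S Φ) →
                   r h₁ s ≡ r h₂ (r h₃ s)
      v-event    : ∀ p → IsEvent (v p)
      -- well-definedness w.r.t. the identification ≈ (encoding coherence)
      Π-resp     : ∀ i ω ω′ → ω ≈ ω′ → Π i ω ≋ Π i ω′
      Λ-resp     : ∀ i ω ω′ → ω ≈ ω′ → Λ i ω ≋ Λ i ω′
      Π-nonempty : ∀ i ω → ∃ λ ω′ → Π i ω ω′
      confinement : ∀ i Φ (s : S Φ) → Σ Sub (λ Ψ → (Ψ ⊆ₛ Φ) × (Π i (Φ , s) ⊆S Ψ))
      gen-refl   : ∀ i Φ (s : S Φ) Ψ → Π i (Φ , s) ⊆S Ψ → upSet Ψ (Π i (Φ , s)) (Φ , s)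
      Π-stat     : ∀ i ω ω′ → Π i ω ω′ → Π i ω′ ≋ Π i ω
      PPI        : ∀ i Φ (s : S Φ) Ψ (h : Ψ ⊆ₛ Φ) Θ Θ′ →
                   Π i (Φ , s) ⊆S Θ → Π i (Ψ , r h s) ⊆S Θ′ →
                   upSet Θ (Π i (Φ , s)) ⊑ upSet Θ′ (Π i (Ψ , r h s))
      PPK        : ∀ i Φ Ψ Υ (h₁ : Υ ⊆ₛ Ψ) (h₂ : Ψ ⊆ₛ Φ) (s : S Φ) →
                   Π i (Φ , s) ⊆S Ψ →
                   proj Ψ Υ h₁ (Π i (Φ , s)) ≋ Π i (Υ , r (⊆ₛ-trans h₁ h₂) s)
      Λ-refl     : ∀ i ω → ∃ λ ω′ → Λ i ω ω′ × (ω ≈ ω′)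
      Λ-stat     : ∀ i ω ω′ → Λ i ω ω′ → Λ i ω′ ≋ Λ i ω
      PPIK       : ∀ i Φ Ψ (h : Ψ ⊆ₛ Φ) (s : S Φ) →
                   proj Φ Ψ h (Λ i (Φ , s)) ≋ Λ i (Ψ , r h s)
      expl-meas  : ∀ i ω ω′ → Λ i ω ω′ → Π i ω′ ≋ Π i ω
      impl-meas  : ∀ i Φ (s : S Φ) ω′ → Π i (Φ , s) ω′ → (h : proj₁ ω′ ⊆ₛ Φ) →
                   Λ i ω′ ≋ proj Φ (proj₁ ω′) h (Λ i (Φ , s))

  module _ (C : FHCategory) where
    open FHCategory C
    open module KΦ′ (Φ : Sub) = FHModel (K Φ)

    -- α_i(w) = S_{At(A_{Φ,i}(w))}; its index is contained in Φ
    αIdx : I → (Φ : Sub) → W Φ → Sub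
    αIdx i Φ w = AtOf (Aw Φ i w)

    αIdx⊆ : ∀ i Φ (w : W Φ) → αIdx i Φ w ⊆ₛ Φ
    αIdx⊆ i Φ w p (φ , a , q) = Aw-L Φ i w φ a p q

    HMS : HMSData
    HMS = record
      { S = λ Φ → W Φ
      ; r = f
      ; Λ = λ { i (Φ , w) ω′ → Σ (W Φ) (λ t → R Φ i w t × (ω′ ≡ (Φ , t))) }
      -- Π_i(w) = Λ_i(w)_{α_i(w)} = r^Φ_{At(A(w))}(Λ_i(w))
      ; Π = λ { i (Φ , w) ω′ → Σ (W Φ) (λ t → R Φ i w t ×
                  (ω′ ≡ (αIdx i Φ w , f (αIdx⊆ i Φ w) t))) }
      ; v = λ { p (Φ , w) → Lift (lsuc 0ℓ) (Σ (Φ p) (λ h → V Φ p h w)) }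
      }

-- Every axiom of a complemented HMS model comes down to three properties of the FH category: any
-- two projections of a common world to the same set of atoms agree (f-∘), the accessibility
-- relations are equivalences that the projections preserve and reflect (f-hom, f-back), and the
-- awareness set α is constant along R and survives projection to any set of atoms containing it
-- (α-R, α-f, α-f-⊇). Since Π is Λ projected to the awareness level, each axiom relating Π and Λ
-- is checked by projecting R-related worlds and comparing the projections.
module Submission where

open import Defs
open import Data.Product using (Σ; _×_; _,_; proj₁)
open import Level using (Lift; lift; 0ℓ) renaming (suc to lsuc)
open import Function.Bundles using (Equivalence)
open import Relation.Binary.Structures using (IsEquivalence)
open import Relation.Binary.PropositionalEquality
  using (_≡_; refl; sym; trans; cong; module ≡-Reasoning)

module HMSTransform (At I : Set) (C : FHCategory At I) where
  open FHCategory C using (K; f; f-surj; f-V; f-Aw; f-hom; f-back; f-id; f-comp)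
  open module Model (Φ : Sub At I) = FHModel (K Φ)
  open Equivalence using (to; from)
  open HMSData (HMS At I C) using (Ω; Λ; Π; v)
  open HMSNotions At I (HMS At I C)

  _⊆_ : Sub At I → Sub At I → Set
  _⊆_ = _⊆ₛ_ At I

  ⊆-refl : {Φ : Sub At I} → Φ ⊆ Φ
  ⊆-refl p x = x

  ⊆-trans : {Υ Ψ Φ : Sub At I} → Υ ⊆ Ψ → Ψ ⊆ Φ → Υ ⊆ Φ
  ⊆-trans = ⊆ₛ-trans At I

  α : I → (Φ : Sub At I) → W Φ → Sub At I
  α = αIdx At I C

  α⊆ : ∀ i Φ (w : W Φ) → α i Φ w ⊆ Φ
  α⊆ = αIdx⊆ At I C

  variable
    Φ Ψ Υ Θ : Sub At I
    i : I

  R-refl : {w : W Φ} → R Φ i w w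
  R-refl {Φ} {i} = IsEquivalence.refl (R-eq Φ i)

  R-sym : {w t : W Φ} → R Φ i w t → R Φ i t w
  R-sym {Φ} {i} = IsEquivalence.sym (R-eq Φ i)

  R-trans : {w t u : W Φ} → R Φ i w t → R Φ i t u → R Φ i w u
  R-trans {Φ} {i} = IsEquivalence.trans (R-eq Φ i)

  f-∘ : (p : Υ ⊆ Ψ) (q : Ψ ⊆ Φ) (r : Υ ⊆ Φ) (w : W Φ) → f p (f q w) ≡ f r w
  f-∘ p q r w = sym (f-comp r p q w)

  ≈-refl : (ω : Ω) → ω ≈ ω
  ≈-refl (Φ , s) = ⊆-refl , ⊆-refl , f-id ⊆-refl s

  ≈-sym : {ω ω′ : Ω} → ω ≈ ω′ → ω′ ≈ ω
  ≈-sym {Φ , s} (h , h′ , refl) = h′ , h , trans (f-∘ h′ h ⊆-refl s) (f-id ⊆-refl s)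

  ≈-projections : (p : Φ ⊆ Θ) (q : Ψ ⊆ Θ) → Ψ ⊆ Φ → Φ ⊆ Ψ → (t : W Θ) {u : W Φ} {u′ : W Ψ} →
                  u ≡ f p t → u′ ≡ f q t → (Φ , u) ≈ (Ψ , u′)
  ≈-projections p q k k′ t refl refl = k , k′ , f-∘ k p q t

  α-R : {w t : W Φ} → R Φ i w t → α i Φ w ⊆ α i Φ t
  α-R {Φ} {i} {w} {t} Rwt p (φ , A , q) = φ , to (Aw-R Φ i w t Rwt φ) A , q

  α-f : (h : Ψ ⊆ Φ) (s : W Φ) → α i Ψ (f h s) ⊆ α i Φ s
  α-f {i = i} h s p (φ , A , q) = φ , proj₁ (from (f-Aw h i s φ) A) , q

  -- Awareness is generated by atoms, so an atom the agent is aware of survives any projection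
  -- whose index set still contains it.
  α-f-⊇ : (h : Ψ ⊆ Φ) (s : W Φ) → Υ ⊆ α i Φ s → Υ ⊆ Ψ → Υ ⊆ α i Ψ (f h s)
  α-f-⊇ {Φ = Φ} {i = i} h s aware inΨ p y with aware p y
  ... | φ , A , q = atom p , to (f-Aw h i s (atom p)) (to (Aw-gen Φ i s φ) A p q , inL) , refl
    where
    inL : L At I _ (atom p)
    inL p′ refl = inΨ p y

  Λ-point : {s t : W Φ} → R Φ i s t → Λ i (Φ , s) (Φ , t)
  Λ-point {t = t} Rst = t , Rst , refl

  Π-point : {s t : W Φ} → R Φ i s t → Π i (Φ , s) (α i Φ s , f (α⊆ i Φ s) t)
  Π-point {t = t} Rst = t , Rst , refl

  v-event : ∀ p → IsEvent (v p)
  v-event p = singleton , D , to-up , from-up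
    where
    singleton : Sub At I
    singleton q = q ≡ p
    D : W singleton → Set₁
    D s = Lift (lsuc 0ℓ) (V singleton p refl s)
    to-up : ∀ ω → v p ω → up singleton D ω
    to-up (Ψ , s) (lift (hΨ , Vs)) = k , lift (to (f-V k p refl hΨ s) Vs)
      where
      k : singleton ⊆ Ψ
      k q refl = hΨ
    from-up : ∀ ω → up singleton D ω → v p ω
    from-up (Ψ , s) (k , lift Vs) = lift (k p refl , from (f-V k p refl (k p refl) s) Vs)

  Λ-resp-⊑ : ∀ i {ω ω′} → ω ≈ ω′ → Λ i ω ⊑ Λ i ω′
  Λ-resp-⊑ i {Φ , s} (h , h′ , refl) _ (t , Rst , refl) =
    _ , Λ-point (f-hom h i s t Rst) , (h , h′ , refl)

  Π-resp-⊑ : ∀ i {ω ω′} → ω ≈ ω′ → Π i ω ⊑ Π i ω′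
  Π-resp-⊑ i {Φ , s} {Φ′ , _} (h , h′ , refl) _ (t , Rst , refl) =
    _ , Π-point (f-hom h i s t Rst) ,
    ≈-projections (α⊆ i Φ s) (⊆-trans (α⊆ i Φ′ (f h s)) h)
      (α-f h s) (α-f-⊇ h s ⊆-refl (⊆-trans (α⊆ i Φ s) h′)) t refl (f-∘ _ h _ t)

  confinement : ∀ i Φ (s : W Φ) → Σ (Sub At I) (λ Ψ → (Ψ ⊆ Φ) × (Π i (Φ , s) ⊆S Ψ))
  confinement i Φ s = α i Φ s , α⊆ i Φ s , λ { _ (_ , _ , refl) → ⊆-refl , ⊆-refl }

  gen-refl : ∀ i Φ (s : W Φ) Ψ → Π i (Φ , s) ⊆S Ψ → upSet Ψ (Π i (Φ , s)) (Φ , s)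
  gen-refl i Φ s Ψ conf with conf _ (Π-point R-refl)
  ... | α⊆Ψ , Ψ⊆α = ⊆-trans Ψ⊆α (α⊆ i Φ s) ,
        _ , Π-point R-refl , ≈-projections (α⊆ i Φ s) _ Ψ⊆α α⊆Ψ s refl refl

  Π-stat : ∀ i ω ω′ → Π i ω ω′ → Π i ω′ ≋ Π i ω
  Π-stat i (Φ , w) _ (t , Rwt , refl) = to-Πw , from-Πw
    where
    a = α⊆ i Φ w
    b = α⊆ i (α i Φ w) (f a t)
    α⊆α : α i Φ w ⊆ α i (α i Φ w) (f a t)
    α⊆α = α-f-⊇ a t (α-R Rwt) ⊆-refl
    to-Πw : Π i (α i Φ w , f a t) ⊑ Π i (Φ , w)
    to-Πw _ (u , Ru , refl) with f-back a i t u Ru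
    ... | t′ , refl , Rtt′ =
      _ , Π-point (R-trans Rwt Rtt′) , ≈-projections (⊆-trans b a) a α⊆α b t′ (f-∘ b a _ t′) refl
    from-Πw : Π i (Φ , w) ⊑ Π i (α i Φ w , f a t)
    from-Πw _ (t′ , Rwt′ , refl) =
      _ , Π-point (f-hom a i t t′ (R-trans (R-sym Rwt) Rwt′)) ,
      ≈-projections a (⊆-trans b a) b α⊆α t′ refl (f-∘ b a _ t′)

  PPI : ∀ i Φ (s : W Φ) Ψ (h : Ψ ⊆ Φ) Θ Θ′ →
        Π i (Φ , s) ⊆S Θ → Π i (Ψ , f h s) ⊆S Θ′ →
        upSet Θ (Π i (Φ , s)) ⊑ upSet Θ′ (Π i (Ψ , f h s))
  PPI i Φ s Ψ h Θ Θ′ _ confΨ (Ξ , x) (k , _ , (t , Rst , refl) , (Θ⊆α , α⊆Θ , e))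
    with confΨ _ (Π-point R-refl)
  ... | αΨ⊆Θ′ , Θ′⊆αΨ =
    (Ξ , x) , (⊆-trans Θ′⊆Θ k , _ , Π-point (f-hom h i s t Rst) ,
      ≈-projections (⊆-trans b h) Θ′⊆Φ Θ′⊆αΨ αΨ⊆Θ′ t (f-∘ b h _ t) x-projects) ,
    ≈-refl (Ξ , x)
    where
    a = α⊆ i Φ s
    b = α⊆ i Ψ (f h s)
    Θ′⊆Θ : Θ′ ⊆ Θ
    Θ′⊆Θ = ⊆-trans Θ′⊆αΨ (⊆-trans (α-f h s) α⊆Θ)
    Θ′⊆Φ : Θ′ ⊆ Φ
    Θ′⊆Φ = ⊆-trans Θ′⊆Θ (⊆-trans Θ⊆α a)
    x-projects : f (⊆-trans Θ′⊆Θ k) x ≡ f Θ′⊆Φ t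
    x-projects = begin
      f (⊆-trans Θ′⊆Θ k) x      ≡⟨ sym (f-∘ Θ′⊆Θ k _ x) ⟩
      f Θ′⊆Θ (f k x)            ≡⟨ cong (f Θ′⊆Θ) (sym e) ⟩
      f Θ′⊆Θ (f Θ⊆α (f a t))    ≡⟨ cong (f Θ′⊆Θ) (f-∘ Θ⊆α a _ t) ⟩
      f Θ′⊆Θ (f (⊆-trans Θ⊆α a) t) ≡⟨ f-∘ Θ′⊆Θ _ Θ′⊆Φ t ⟩
      f Θ′⊆Φ t                  ∎
      where open ≡-Reasoning

  PPK : ∀ i Φ Ψ Υ (h₁ : Υ ⊆ Ψ) (h₂ : Ψ ⊆ Φ) (s : W Φ) → Π i (Φ , s) ⊆S Ψ →
        proj Ψ Υ h₁ (Π i (Φ , s)) ≋ Π i (Υ , f (⊆-trans h₁ h₂) s)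
  PPK i Φ Ψ Υ h₁ h₂ s conf with conf _ (Π-point R-refl)
  ... | α⊆Ψ , Ψ⊆α = to-Π , from-Π
    where
    h = ⊆-trans h₁ h₂
    a = α⊆ i Φ s
    c = α⊆ i Υ (f h s)
    Υ⊆α : Υ ⊆ α i Υ (f h s)
    Υ⊆α = α-f-⊇ h s (⊆-trans h₁ Ψ⊆α) ⊆-refl
    to-Π : proj Ψ Υ h₁ (Π i (Φ , s)) ⊑ Π i (Υ , f h s)
    to-Π _ (_ , (_ , (t , Rst , refl) , (Ψ⊆α′ , _ , refl)) , refl) =
      _ , Π-point (f-hom h i s t Rst) ,
      ≈-projections h (⊆-trans c h) c Υ⊆α t
        (trans (cong (f h₁) (f-∘ Ψ⊆α′ a h₂ t)) (f-∘ h₁ h₂ h t)) (f-∘ c h _ t)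
    from-Π : Π i (Υ , f h s) ⊑ proj Ψ Υ h₁ (Π i (Φ , s))
    from-Π _ (u , Ru , refl) with f-back h i s u Ru
    ... | t , refl , Rst =
      _ , (f h₂ t , (_ , Π-point Rst , (Ψ⊆α , α⊆Ψ , f-∘ Ψ⊆α a h₂ t)) , refl) ,
      ≈-projections (⊆-trans c h) h Υ⊆α c t (f-∘ c h _ t) (f-∘ h₁ h₂ h t)

  Λ-stat : ∀ i ω ω′ → Λ i ω ω′ → Λ i ω′ ≋ Λ i ω
  Λ-stat i (Φ , w) _ (t , Rwt , refl) =
    (λ { _ (u , Rtu , refl) → _ , Λ-point (R-trans Rwt Rtu) , ≈-refl _ }) ,
    (λ { _ (u , Rwu , refl) → _ , Λ-point (R-trans (R-sym Rwt) Rwu) , ≈-refl _ })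

  PPIK : ∀ i Φ Ψ (h : Ψ ⊆ Φ) (s : W Φ) → proj Φ Ψ h (Λ i (Φ , s)) ≋ Λ i (Ψ , f h s)
  PPIK i Φ Ψ h s = to-Λ , from-Λ
    where
    to-Λ : proj Φ Ψ h (Λ i (Φ , s)) ⊑ Λ i (Ψ , f h s)
    to-Λ _ (_ , (_ , (t , Rst , refl) , (k , _ , refl)) , refl) =
      _ , Λ-point (f-hom h i s t Rst) , ≈-projections h h ⊆-refl ⊆-refl t (f-∘ h k h t) refl
    from-Λ : Λ i (Ψ , f h s) ⊑ proj Φ Ψ h (Λ i (Φ , s))
    from-Λ _ (u , Ru , refl) with f-back h i s u Ru
    ... | t , refl , Rst = _ , (t , (_ , Λ-point Rst , ≈-refl _) , refl) , ≈-refl _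

  explicit-measurability : ∀ i ω ω′ → Λ i ω ω′ → Π i ω′ ≋ Π i ω
  explicit-measurability i (Φ , w) _ (t , Rwt , refl) = Πt⊑Πw , Πw⊑Πt
    where
    aw = α⊆ i Φ w
    at = α⊆ i Φ t
    Πt⊑Πw : Π i (Φ , t) ⊑ Π i (Φ , w)
    Πt⊑Πw _ (u , Rtu , refl) =
      _ , Π-point (R-trans Rwt Rtu) , ≈-projections at aw (α-R Rwt) (α-R (R-sym Rwt)) u refl refl
    Πw⊑Πt : Π i (Φ , w) ⊑ Π i (Φ , t)
    Πw⊑Πt _ (u , Rwu , refl) =
      _ , Π-point (R-trans (R-sym Rwt) Rwu) ,
      ≈-projections aw at (α-R (R-sym Rwt)) (α-R Rwt) u refl refl

  implicit-measurability : ∀ i Φ (s : W Φ) ω′ → Π i (Φ , s) ω′ → (h : proj₁ ω′ ⊆ Φ) →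
                           Λ i ω′ ≋ proj Φ (proj₁ ω′) h (Λ i (Φ , s))
  implicit-measurability i Φ s _ (t , Rst , refl) h = to-proj , from-proj
    where
    a = α⊆ i Φ s
    to-proj : Λ i (α i Φ s , f a t) ⊑ proj Φ (α i Φ s) h (Λ i (Φ , s))
    to-proj _ (u , Ru , refl) with f-back a i t u Ru
    ... | t′ , refl , Rtt′ =
      _ , (t′ , (_ , Λ-point (R-trans Rst Rtt′) , ≈-refl _) , refl) ,
      ≈-projections a h ⊆-refl ⊆-refl t′ refl refl
    from-proj : proj Φ (α i Φ s) h (Λ i (Φ , s)) ⊑ Λ i (α i Φ s , f a t)
    from-proj _ (_ , (_ , (t′ , Rst′ , refl) , (k , _ , refl)) , refl) =
      _ , Λ-point (f-hom a i t t′ (R-trans (R-sym Rst) Rst′)) ,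
      ≈-projections h a ⊆-refl ⊆-refl t′ (f-∘ h k h t′) refl

  isComplementedHMS : IsComplementedHMS At I (HMS At I C)
  isComplementedHMS = record
    { S-nonempty  = w₀
    ; r-surj      = f-surj
    ; r-id        = f-id
    ; r-comp      = f-comp
    ; v-event     = v-event
    ; Π-resp      = λ i _ _ e → Π-resp-⊑ i e , Π-resp-⊑ i (≈-sym e)
    ; Λ-resp      = λ i _ _ e → Λ-resp-⊑ i e , Λ-resp-⊑ i (≈-sym e)
    ; Π-nonempty  = λ { i (Φ , s) → _ , Π-point R-refl }
    ; confinement = confinement
    ; gen-refl    = gen-refl
    ; Π-stat      = Π-stat
    ; PPI         = PPI
    ; PPK         = PPK
    ; Λ-refl      = λ { i (Φ , s) → _ , Λ-point R-refl , ≈-refl _ }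
    ; Λ-stat      = Λ-stat
    ; PPIK        = PPIK
    ; expl-meas   = explicit-measurability
    ; impl-meas   = implicit-measurability
    }

corollary2 : (At I : Set) → At → I → (C : FHCategory At I) →
             IsComplementedHMS At I (HMS At I C)
corollary2 At I _ _ C = HMSTransform.isComplementedHMS At I C
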